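{- Let $Q$ be a quadrilateral in standard form over a field $\mathbb{k}$ of characteristic $\neq2$. Then the centroid of $Q$ is the origin if and only if the vertices of $Q$ are the vertices of a parallelogram.
   Context: A quadrilateral $Q=ABA'B'$: four distinct lines, not all concurrent, adjacent sides ($\{A,B\},\{B,A'\},\{A',B'\},\{B',A\}$) not parallel. Vertices $A\cap B,B\cap A',A'\cap B',B'\cap A$ (two may coincide); centroid = average of the four vertices. $Q$ is in standard form if $A$ is $Y=0$ and $A'$ is $X=0$. A parallelogram is a quadrilateral both of whose pairs of opposite sides are parallel; "the vertices of $Q$ are the vertices of a parallelogram" means the vertex set of $Q$ equals that of some parallelogram. -}

module Defs where

open import Level using (Level; _⊔_; suc)
open import Algebra.Bundles using (CommutativeRing)
open import Data.Product using (Σ; ∃; _×_; _,_)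
open import Data.Sum using (_⊎_)
open import Relation.Nullary using (¬_)
open import Function.Bundles using (_⇔_)

record Field (c ℓ : Level) : Set (suc (c ⊔ ℓ)) where
  field
    commutativeRing : CommutativeRing c ℓ
  open CommutativeRing commutativeRing public
  field
    1≉0     : ¬ (1# ≈ 0#)
    inverse : ∀ x → ¬ (x ≈ 0#) → Σ Carrier (λ y → x * y ≈ 1#)

module Geometry {c ℓ : Level} (F : Field c ℓ) where
  open Field F

  CharNot2 : Set ℓ
  CharNot2 = ¬ ((1# + 1#) ≈ 0#)

  Point : Set c
  Point = Carrier × Carrier

  origin : Point
  origin = (0# , 0#)

  _≈ᴾ_ : Point → Point → Set ℓ
  (x , y) ≈ᴾ (x' , y') = (x ≈ x') × (y ≈ y')

  record Line : Set (c ⊔ ℓ) where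
    constructor line
    field
      a b k   : Carrier
      nonzero : ¬ ((a ≈ 0#) × (b ≈ 0#))

  OnLine : Point → Line → Set ℓ
  OnLine (x , y) L = ((Line.a L * x) + (Line.b L * y)) ≈ Line.k L

  SameLine : Line → Line → Set (c ⊔ ℓ)
  SameLine L M = ∀ p → OnLine p L ⇔ OnLine p M

  Distinct : Line → Line → Set (c ⊔ ℓ)
  Distinct L M = ¬ SameLine L M

  Parallel : Line → Line → Set ℓ
  Parallel L M = (Line.a L * Line.b M) ≈ (Line.a M * Line.b L)

  lineY=0 : Line
  lineY=0 = line 0# 1# 0# (λ { (_ , 1≈0) → 1≉0 1≈0 })

  lineX=0 : Line
  lineX=0 = line 1# 0# 0# (λ { (1≈0 , _) → 1≉0 1≈0 })

  record Quadrilateral : Set (c ⊔ ℓ) where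
    field
      A B A' B' : Line
      dAB   : Distinct A B
      dAA'  : Distinct A A'
      dAB'  : Distinct A B'
      dBA'  : Distinct B A'
      dBB'  : Distinct B B'
      dA'B' : Distinct A' B'
      notConcurrent : ¬ (Σ Point λ p → OnLine p A × OnLine p B × OnLine p A' × OnLine p B')
      npAB   : ¬ Parallel A B
      npBA'  : ¬ Parallel B A'
      npA'B' : ¬ Parallel A' B'
      npB'A  : ¬ Parallel B' A

  open Quadrilateral public

  IsVertex : Quadrilateral → Point → Set ℓ
  IsVertex Q p =
      (OnLine p (A Q) × OnLine p (B Q))
    ⊎ (OnLine p (B Q) × OnLine p (A' Q))
    ⊎ (OnLine p (A' Q) × OnLine p (B' Q))
    ⊎ (OnLine p (B' Q) × OnLine p (A Q))

  StandardForm : Quadrilateral → Set (c ⊔ ℓ)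
  StandardForm Q = SameLine (A Q) lineY=0 × SameLine (A' Q) lineX=0

  IsCentroidOf : Point → Point → Point → Point → Point → Set ℓ
  IsCentroidOf (gx , gy) (x₁ , y₁) (x₂ , y₂) (x₃ , y₃) (x₄ , y₄) =
      (((1# + 1#) + (1# + 1#)) * gx) ≈ (((x₁ + x₂) + x₃) + x₄)
    × (((1# + 1#) + (1# + 1#)) * gy) ≈ (((y₁ + y₂) + y₃) + y₄)

  -- the centroid of Q is the origin: taking v₁ = A∩B, v₂ = B∩A', v₃ = A'∩B',
  -- v₄ = B'∩A (each uniquely determined, adjacent sides being non-parallel),
  -- the origin is their average.
  CentroidIsOrigin : Quadrilateral → Set (c ⊔ ℓ)
  CentroidIsOrigin Q = ∀ v₁ v₂ v₃ v₄ →
      OnLine v₁ (A Q) → OnLine v₁ (B Q) →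
      OnLine v₂ (B Q) → OnLine v₂ (A' Q) →
      OnLine v₃ (A' Q) → OnLine v₃ (B' Q) →
      OnLine v₄ (B' Q) → OnLine v₄ (A Q) →
      IsCentroidOf origin v₁ v₂ v₃ v₄

  IsParallelogram : Quadrilateral → Set ℓ
  IsParallelogram P = Parallel (A P) (A' P) × Parallel (B P) (B' P)

  VerticesOfParallelogram : Quadrilateral → Set (c ⊔ ℓ)
  VerticesOfParallelogram Q =
    ∃ λ (P : Quadrilateral) → IsParallelogram P × (∀ p → IsVertex Q p ⇔ IsVertex P p)

{-# OPTIONS --safe #-}
-- In standard form the vertices are v₁ = (x₁ , 0), v₄ = (x₄ , 0) on A and
-- v₂ = (0 , y₂), v₃ = (0 , y₃) on A', so the centroid is the origin iff
-- v₁ + v₄ = v₂ + v₃, i.e. x₄ = - x₁ and y₃ = - y₂.  Then the vertices of Q are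
-- those of the rhombus (± x₁ , 0), (0 , ± y₂), which is nondegenerate because
-- the sides of Q are not concurrent and 2 ≠ 0.  Conversely, the vertices
-- w₁, …, w₄ of a parallelogram are pairwise distinct and its diagonals bisect
-- each other, w₁ + w₃ = w₂ + w₄.  Since each vᵢ lies on an axis, the only way to
-- split {v₁, …, v₄} into two pairs with equal sums without making two vertices
-- coincide is {v₁, v₄}, {v₂, v₃}.
module Submission where

open import Defs
open import Level using (Level; _⊔_)
open import Algebra.Bundles using (CommutativeRing)
open import Data.Integer as ℤ using (ℤ; +_; -[1+_]; _⊖_)
import Data.Integer.Properties as ℤ
open import Data.Nat as ℕ using (zero; suc)
import Data.Nat.Properties as ℕ
open import Data.Sign as Sign using (Sign)
open import Data.Maybe using (Maybe; just; nothing)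
open import Data.Product using (Σ-syntax; _×_; _,_; proj₁; proj₂)
open import Data.Sum using (_⊎_; inj₁; inj₂)
open import Data.Empty using (⊥; ⊥-elim)
open import Function.Bundles using (_⇔_; mk⇔; Equivalence)
open import Function.Construct.Composition using (_⇔-∘_)
open import Function.Construct.Symmetry using (⇔-sym)
open import Relation.Nullary using (¬_; yes; no)
import Relation.Binary.PropositionalEquality as ≡

-- The ring solver cancels monomials only when it can decide equality of their
-- coefficients, so it is run with integer coefficients along the ring map ℤ → R.
-- The multiples n · 1# are the type-checking-optimised ones, so that ⟦ + 1 ⟧ℤ and
-- ⟦ + 2 ⟧ℤ are definitionally 1# and 1# + 1#.
module IntegerCoefficientRingSolver {c ℓ : Level} (R : CommutativeRing c ℓ) where
  open CommutativeRing R
  open import Algebra.Properties.Semiring.Mult.TCOptimised semiring using (1+×; ×-homo-+; ×1-homo-*)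
    renaming (_×_ to _·_)
  open import Algebra.Properties.Ring ring using (-0#≈0#; -‿involutive; -‿distribˡ-*; -‿distribʳ-*; -‿+-comm)
  open import Algebra.Solver.Ring.AlmostCommutativeRing using (_-Raw-AlmostCommutative⟶_; fromCommutativeRing)
  open import Relation.Binary.Reasoning.Setoid setoid

  ⟦_⟧ℤ : ℤ → Carrier
  ⟦ + n ⟧ℤ      = n · 1#
  ⟦ -[1+ n ] ⟧ℤ = - (suc n · 1#)

  ⊖-homo : ∀ m n → ⟦ m ⊖ n ⟧ℤ ≈ m · 1# - n · 1#
  ⊖-homo m       zero    = sym (trans (+-congˡ -0#≈0#) (+-identityʳ _))
  ⊖-homo zero    (suc n) = sym (+-identityˡ _)
  ⊖-homo (suc m) (suc n) = begin
    ⟦ suc m ⊖ suc n ⟧ℤ               ≡⟨ ≡.cong ⟦_⟧ℤ (ℤ.[1+m]⊖[1+n]≡m⊖n m n) ⟩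
    ⟦ m ⊖ n ⟧ℤ                        ≈⟨ ⊖-homo m n ⟩
    m · 1# - n · 1#                   ≈⟨ +-congʳ (+-identityˡ _) ⟨
    (0# + m · 1#) - n · 1#            ≈⟨ +-congʳ (+-congʳ (-‿inverseʳ 1#)) ⟨
    ((1# - 1#) + m · 1#) - n · 1#     ≈⟨ +-congʳ (+-assoc _ _ _) ⟩
    (1# + (- 1# + m · 1#)) - n · 1#   ≈⟨ +-congʳ (+-congˡ (+-comm _ _)) ⟩
    (1# + (m · 1# - 1#)) - n · 1#     ≈⟨ +-congʳ (+-assoc _ _ _) ⟨
    ((1# + m · 1#) - 1#) - n · 1#     ≈⟨ +-assoc _ _ _ ⟩
    (1# + m · 1#) + (- 1# - n · 1#)   ≈⟨ +-congˡ (-‿+-comm 1# (n · 1#)) ⟩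
    (1# + m · 1#) - (1# + n · 1#)     ≈⟨ +-cong (1+× m 1#) (-‿cong (1+× n 1#)) ⟨
    suc m · 1# - suc n · 1#           ∎

  +-homo : ∀ i j → ⟦ i ℤ.+ j ⟧ℤ ≈ ⟦ i ⟧ℤ + ⟦ j ⟧ℤ
  +-homo (+ m)    (+ n)    = ×-homo-+ 1# m n
  +-homo (+ m)    -[1+ n ] = ⊖-homo m (suc n)
  +-homo -[1+ m ] (+ n)    = trans (⊖-homo n (suc m)) (+-comm _ _)
  +-homo -[1+ m ] -[1+ n ] = begin
    - (suc (suc (m ℕ.+ n)) · 1#)   ≡⟨ ≡.cong (λ k → - (suc k · 1#)) (ℕ.+-suc m n) ⟨
    - ((suc m ℕ.+ suc n) · 1#)     ≈⟨ -‿cong (×-homo-+ 1# (suc m) (suc n)) ⟩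
    - (suc m · 1# + suc n · 1#)    ≈⟨ -‿+-comm _ _ ⟨
    - (suc m · 1#) - suc n · 1#    ∎

  signed : Sign → Carrier → Carrier
  signed Sign.+ x = x
  signed Sign.- x = - x

  signed-cong : ∀ s {x y} → x ≈ y → signed s x ≈ signed s y
  signed-cong Sign.+ x≈y = x≈y
  signed-cong Sign.- x≈y = -‿cong x≈y

  signed-* : ∀ s t x y → signed (s Sign.* t) (x * y) ≈ signed s x * signed t y
  signed-* Sign.+ Sign.+ x y = refl
  signed-* Sign.+ Sign.- x y = -‿distribʳ-* x y
  signed-* Sign.- Sign.+ x y = -‿distribˡ-* x y
  signed-* Sign.- Sign.- x y = begin
    x * y          ≈⟨ -‿involutive _ ⟨
    - - (x * y)    ≈⟨ -‿cong (-‿distribˡ-* x y) ⟩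
    - (- x * y)    ≈⟨ -‿distribʳ-* (- x) y ⟩
    - x * - y      ∎

  ◃-homo : ∀ s n → ⟦ s ℤ.◃ n ⟧ℤ ≈ signed s (n · 1#)
  ◃-homo Sign.+ zero    = refl
  ◃-homo Sign.- zero    = sym -0#≈0#
  ◃-homo Sign.+ (suc n) = refl
  ◃-homo Sign.- (suc n) = refl

  ⟦⟧ℤ-signAbs : ∀ i → ⟦ i ⟧ℤ ≈ signed (ℤ.sign i) (ℤ.∣ i ∣ · 1#)
  ⟦⟧ℤ-signAbs (+ n)    = refl
  ⟦⟧ℤ-signAbs -[1+ n ] = refl

  *-homo : ∀ i j → ⟦ i ℤ.* j ⟧ℤ ≈ ⟦ i ⟧ℤ * ⟦ j ⟧ℤ
  *-homo i j = begin
    ⟦ (s Sign.* t) ℤ.◃ (m ℕ.* n) ⟧ℤ            ≈⟨ ◃-homo (s Sign.* t) (m ℕ.* n) ⟩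
    signed (s Sign.* t) ((m ℕ.* n) · 1#)       ≈⟨ signed-cong (s Sign.* t) (×1-homo-* m n) ⟩
    signed (s Sign.* t) ((m · 1#) * (n · 1#))  ≈⟨ signed-* s t _ _ ⟩
    signed s (m · 1#) * signed t (n · 1#)      ≈⟨ *-cong (⟦⟧ℤ-signAbs i) (⟦⟧ℤ-signAbs j) ⟨
    ⟦ i ⟧ℤ * ⟦ j ⟧ℤ                             ∎
    where
    s = ℤ.sign i
    t = ℤ.sign j
    m = ℤ.∣ i ∣
    n = ℤ.∣ j ∣

  -‿homo : ∀ i → ⟦ ℤ.- i ⟧ℤ ≈ - ⟦ i ⟧ℤ
  -‿homo (+ zero)  = sym -0#≈0#
  -‿homo (+ suc n) = refl
  -‿homo -[1+ n ]  = sym (-‿involutive _)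

  ℤ⟶R : ℤ.+-*-rawRing -Raw-AlmostCommutative⟶ fromCommutativeRing R
  ℤ⟶R = record
    { ⟦_⟧    = ⟦_⟧ℤ
    ; +-homo = +-homo
    ; *-homo = *-homo
    ; -‿homo = -‿homo
    ; 0-homo = refl
    ; 1-homo = refl
    }

  ⟦⟧ℤ-≟ : ∀ i j → Maybe (⟦ i ⟧ℤ ≈ ⟦ j ⟧ℤ)
  ⟦⟧ℤ-≟ i j with i ℤ.≟ j
  ... | yes ≡.refl = just refl
  ... | no _       = nothing

  open import Algebra.Solver.Ring ℤ.+-*-rawRing (fromCommutativeRing R) ℤ⟶R ⟦⟧ℤ-≟ public

module PlaneGeometry {c ℓ : Level} (F : Field c ℓ) where
  open Field F
  open Geometry F
  open IntegerCoefficientRingSolver commutativeRing using (Polynomial; solve; _:=_; _:+_; _:*_; _:-_; :-_; con)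
  open import Algebra.Properties.Ring ring using (-0#≈0#; +-cancelʳ; +-inverseʳ-unique)
  open import Relation.Binary.Reasoning.Setoid setoid
  open Line

  -- To derive L ≈ R from S ≈ T, let the ring solver prove L + T ≈ R + S.
  linear-combination : ∀ {L R S T} → L + T ≈ R + S → S ≈ T → L ≈ R
  linear-combination {L} {R} {S} {T} L+T≈R+S S≈T =
    +-cancelʳ T L R (trans L+T≈R+S (+-congˡ S≈T))

  *-cancelˡ-nonzero : ∀ {x u v} → ¬ x ≈ 0# → x * u ≈ x * v → u ≈ v
  *-cancelˡ-nonzero {x} {u} {v} x≉0 xu≈xv with inverse x x≉0
  ... | y , xy≈1 = begin
    u             ≈⟨ *-identityˡ u ⟨
    1# * u        ≈⟨ *-congʳ xy≈1 ⟨
    (x * y) * u   ≈⟨ *-congʳ (*-comm x y) ⟩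
    (y * x) * u   ≈⟨ *-assoc y x u ⟩
    y * (x * u)   ≈⟨ *-congˡ xu≈xv ⟩
    y * (x * v)   ≈⟨ *-assoc y x v ⟨
    (y * x) * v   ≈⟨ *-congʳ (*-comm y x) ⟩
    (x * y) * v   ≈⟨ *-congʳ xy≈1 ⟩
    1# * v        ≈⟨ *-identityˡ v ⟩
    v             ∎

  nonzero-* : ∀ {x y} → ¬ x ≈ 0# → ¬ y ≈ 0# → ¬ x * y ≈ 0#
  nonzero-* x≉0 y≉0 xy≈0 = y≉0 (*-cancelˡ-nonzero x≉0 (trans xy≈0 (sym (zeroʳ _))))

  :0 :1 :2 : ∀ {n} → Polynomial n
  :0 = con (+ 0)
  :1 = con (+ 1)
  :2 = con (+ 2)

  infixl 25 _+ᴾ_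
  _+ᴾ_ : Point → Point → Point
  (x , y) +ᴾ (x' , y') = (x + x' , y + y')

  ≈ᴾ-refl : ∀ {p} → p ≈ᴾ p
  ≈ᴾ-refl = refl , refl

  ≈ᴾ-sym : ∀ {p q} → p ≈ᴾ q → q ≈ᴾ p
  ≈ᴾ-sym (x≈ , y≈) = sym x≈ , sym y≈

  ≈ᴾ-trans : ∀ {p q r} → p ≈ᴾ q → q ≈ᴾ r → p ≈ᴾ r
  ≈ᴾ-trans (x≈ , y≈) (x≈' , y≈') = trans x≈ x≈' , trans y≈ y≈'

  +ᴾ-cong : ∀ {p p' q q'} → p ≈ᴾ p' → q ≈ᴾ q' → p +ᴾ q ≈ᴾ p' +ᴾ q'
  +ᴾ-cong (x≈ , y≈) (x≈' , y≈') = +-cong x≈ x≈' , +-cong y≈ y≈'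

  +ᴾ-comm : ∀ p q → p +ᴾ q ≈ᴾ q +ᴾ p
  +ᴾ-comm (x , y) (x' , y') = +-comm x x' , +-comm y y'

  _⟦_⟧ : Line → Point → Carrier
  L ⟦ (x , y) ⟧ = a L * x + b L * y

  ⟦⟧-cong : ∀ L {p q} → p ≈ᴾ q → L ⟦ p ⟧ ≈ L ⟦ q ⟧
  ⟦⟧-cong L (x≈ , y≈) = +-cong (*-congˡ x≈) (*-congˡ y≈)

  ⟦⟧-+ : ∀ L p q → L ⟦ p +ᴾ q ⟧ ≈ L ⟦ p ⟧ + L ⟦ q ⟧
  ⟦⟧-+ L (x , y) (x' , y') =
    solve 6 (λ a b x y x' y' → a :* (x :+ x') :+ b :* (y :+ y') := (a :* x :+ b :* y) :+ (a :* x' :+ b :* y'))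
      refl (a L) (b L) x y x' y'

  onLine-resp : ∀ L {p q} → p ≈ᴾ q → OnLine p L → OnLine q L
  onLine-resp L p≈q p∈L = trans (sym (⟦⟧-cong L p≈q)) p∈L

  det : Line → Line → Carrier
  det L M = a L * b M - a M * b L

  ¬parallel⇒det≉0 : ∀ L M → ¬ Parallel L M → ¬ det L M ≈ 0#
  ¬parallel⇒det≉0 L M ∦ det≈0 = ∦ (linear-combination
    (solve 4 (λ aL bL aM bM → aL :* bM :+ :0 := aM :* bL :+ (aL :* bM :- aM :* bL))
      refl (a L) (b L) (a M) (b M))
    det≈0)

  -- Knowing only that (a , b) is not zero, one cannot divide by a or by b;
  -- a unimodular combination is the usable form, and any non-parallel line supplies one.
  Unimodular : Line → Set (c ⊔ ℓ)
  Unimodular L = Σ[ α ∈ Carrier ] Σ[ β ∈ Carrier ] α * a L + β * b L ≈ 1#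

  ¬parallel⇒unimodular : ∀ L M → ¬ Parallel L M → Unimodular L
  ¬parallel⇒unimodular L M ∦ with inverse (det L M) (¬parallel⇒det≉0 L M ∦)
  ... | e , det·e≈1 = b M * e , - (a M * e) , linear-combination
    (solve 5 (λ aL bL aM bM e → (bM :* e) :* aL :+ (:- (aM :* e)) :* bL :+ :1 := :1 :+ (aL :* bM :- aM :* bL) :* e)
      refl (a L) (b L) (a M) (b M) e)
    det·e≈1

  Meet : Line → Line → Set (c ⊔ ℓ)
  Meet L M = Σ[ p ∈ Point ] OnLine p L × OnLine p M

  meet : ∀ L M → ¬ Parallel L M → Meet L M
  meet L M ∦ with inverse (det L M) (¬parallel⇒det≉0 L M ∦)
  ... | e , det·e≈1 = ((k L * b M - k M * b L) * e , (a L * k M - a M * k L) * e)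
    , linear-combination
        (solve 7 (λ aL bL kL aM bM kM e →
            aL :* ((kL :* bM :- kM :* bL) :* e) :+ bL :* ((aL :* kM :- aM :* kL) :* e) :+ kL :* :1
         := kL :+ kL :* ((aL :* bM :- aM :* bL) :* e))
          refl (a L) (b L) (k L) (a M) (b M) (k M) e)
        (*-congˡ det·e≈1)
    , linear-combination
        (solve 7 (λ aL bL kL aM bM kM e →
            aM :* ((kL :* bM :- kM :* bL) :* e) :+ bM :* ((aL :* kM :- aM :* kL) :* e) :+ kM :* :1
         := kM :+ kM :* ((aL :* bM :- aM :* bL) :* e))
          refl (a L) (b L) (k L) (a M) (b M) (k M) e)
        (*-congˡ det·e≈1)

  -- Cramer's rule: det · Δx = b_M ΔL - b_L ΔM and det · Δy = a_L ΔM - a_M ΔL.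
  ¬parallel⇒injective : ∀ L M {p q} → ¬ Parallel L M →
    L ⟦ p ⟧ ≈ L ⟦ q ⟧ → M ⟦ p ⟧ ≈ M ⟦ q ⟧ → p ≈ᴾ q
  ¬parallel⇒injective L M {x , y} {x' , y'} ∦ Lp≈Lq Mp≈Mq
    with inverse (det L M) (¬parallel⇒det≉0 L M ∦)
  ... | e , det·e≈1 =
      linear-combination
        (solve 9 (λ aL bL aM bM e x y x' y' →
            x :+ ((x' :- x) :* :1 :+ (e :* bM) :* (aL :* x' :+ bL :* y') :+ (:- (e :* bL)) :* (aM :* x' :+ bM :* y'))
         := x' :+ ((x' :- x) :* ((aL :* bM :- aM :* bL) :* e) :+ (e :* bM) :* (aL :* x :+ bL :* y) :+ (:- (e :* bL)) :* (aM :* x :+ bM :* y)))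
          refl (a L) (b L) (a M) (b M) e x y x' y')
        (+-cong (+-cong (*-congˡ det·e≈1) (*-congˡ Lp≈Lq)) (*-congˡ Mp≈Mq))
    , linear-combination
        (solve 9 (λ aL bL aM bM e x y x' y' →
            y :+ ((y' :- y) :* :1 :+ (:- (e :* aM)) :* (aL :* x' :+ bL :* y') :+ (e :* aL) :* (aM :* x' :+ bM :* y'))
         := y' :+ ((y' :- y) :* ((aL :* bM :- aM :* bL) :* e) :+ (:- (e :* aM)) :* (aL :* x :+ bL :* y) :+ (e :* aL) :* (aM :* x :+ bM :* y)))
          refl (a L) (b L) (a M) (b M) e x y x' y')
        (+-cong (+-cong (*-congˡ det·e≈1) (*-congˡ Lp≈Lq)) (*-congˡ Mp≈Mq))

  meet-unique : ∀ L M {p q} → ¬ Parallel L M →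
    OnLine p L → OnLine p M → OnLine q L → OnLine q M → p ≈ᴾ q
  meet-unique L M ∦ p∈L p∈M q∈L q∈M = ¬parallel⇒injective L M ∦ (trans p∈L (sym q∈L)) (trans p∈M (sym q∈M))

  -- M (q - p) = (α a_L + β b_L) M (q - p) = (α a_M + β b_M) L (q - p), as a_L b_M = a_M b_L.
  parallel⇒sameLevels : ∀ L M {p q} → Parallel L M → Unimodular L →
    L ⟦ p ⟧ ≈ L ⟦ q ⟧ → M ⟦ p ⟧ ≈ M ⟦ q ⟧
  parallel⇒sameLevels L M {u , v} {u' , v'} ∥ (α , β , αa+βb≈1) Lp≈Lq = linear-combination
    (solve 10 (λ aL bL aM bM u v u' v' α β →
        aM :* u :+ bM :* v :+ ((aM :* u' :+ bM :* v' :- (aM :* u :+ bM :* v)) :* :1 :+ (α :* aM :+ β :* bM) :* (aL :* u' :+ bL :* v') :+ (α :* (v :- v') :- β :* (u :- u')) :* (aM :* bL))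
     := aM :* u' :+ bM :* v' :+ ((aM :* u' :+ bM :* v' :- (aM :* u :+ bM :* v)) :* (α :* aL :+ β :* bL) :+ (α :* aM :+ β :* bM) :* (aL :* u :+ bL :* v) :+ (α :* (v :- v') :- β :* (u :- u')) :* (aL :* bM)))
      refl (a L) (b L) (a M) (b M) u v u' v' α β)
    (+-cong (+-cong (*-congˡ αa+βb≈1) (*-congˡ Lp≈Lq)) (*-congˡ ∥))

  parallel⇒sameLine : ∀ L M {p} → Parallel L M → Unimodular L → Unimodular M →
    OnLine p L → OnLine p M → SameLine L M
  parallel⇒sameLine L M ∥ uL uM p∈L p∈M q = mk⇔
    (λ q∈L → trans (parallel⇒sameLevels L M ∥ uL (trans q∈L (sym p∈L))) p∈M)
    (λ q∈M → trans (parallel⇒sameLevels M L (sym ∥) uM (trans q∈M (sym p∈M))) p∈L)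

  parallel-apart : ∀ L M {p q} → Parallel L M → Unimodular L → Unimodular M → Distinct L M →
    OnLine p L → OnLine q M → ¬ p ≈ᴾ q
  parallel-apart L M ∥ uL uM L≠M p∈L q∈M p≈q =
    L≠M (parallel⇒sameLine L M ∥ uL uM p∈L (onLine-resp M (≈ᴾ-sym p≈q) q∈M))

  record VertexList (Q : Quadrilateral) : Set (c ⊔ ℓ) where
    field
      v₁ v₂ v₃ v₄ : Point
      v₁∈A  : OnLine v₁ (A Q)
      v₁∈B  : OnLine v₁ (B Q)
      v₂∈B  : OnLine v₂ (B Q)
      v₂∈A' : OnLine v₂ (A' Q)
      v₃∈A' : OnLine v₃ (A' Q)
      v₃∈B' : OnLine v₃ (B' Q)
      v₄∈B' : OnLine v₄ (B' Q)
      v₄∈A  : OnLine v₄ (A Q)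

  vertexList : (Q : Quadrilateral) → VertexList Q
  vertexList Q = record
    { v₁∈A  = proj₁ (proj₂ AB)   ; v₁∈B  = proj₂ (proj₂ AB)
    ; v₂∈B  = proj₁ (proj₂ BA')  ; v₂∈A' = proj₂ (proj₂ BA')
    ; v₃∈A' = proj₁ (proj₂ A'B') ; v₃∈B' = proj₂ (proj₂ A'B')
    ; v₄∈B' = proj₁ (proj₂ B'A)  ; v₄∈A  = proj₂ (proj₂ B'A)
    }
    where
    AB : Meet (A Q) (B Q)
    AB = meet (A Q) (B Q) (npAB Q)
    BA' : Meet (B Q) (A' Q)
    BA' = meet (B Q) (A' Q) (npBA' Q)
    A'B' : Meet (A' Q) (B' Q)
    A'B' = meet (A' Q) (B' Q) (npA'B' Q)
    B'A : Meet (B' Q) (A Q)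
    B'A = meet (B' Q) (A Q) (npB'A Q)

  OneOf₂ : Point → Point → Point → Set ℓ
  OneOf₂ u u' p = p ≈ᴾ u ⊎ p ≈ᴾ u'

  OneOf₄ : Point → Point → Point → Point → Point → Set ℓ
  OneOf₄ w₁ w₂ w₃ w₄ p = p ≈ᴾ w₁ ⊎ p ≈ᴾ w₂ ⊎ p ≈ᴾ w₃ ⊎ p ≈ᴾ w₄

  oneOf₄-swap₃₄ : ∀ {u₁ u₂ u₃ u₄ w₁ w₂ w₃ w₄ p} →
    u₁ ≈ᴾ w₁ → u₂ ≈ᴾ w₂ → u₃ ≈ᴾ w₄ → u₄ ≈ᴾ w₃ → OneOf₄ u₁ u₂ u₃ u₄ p → OneOf₄ w₁ w₂ w₃ w₄ p
  oneOf₄-swap₃₄ e₁ _ _ _ (inj₁ p≈u₁)               = inj₁ (≈ᴾ-trans p≈u₁ e₁)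
  oneOf₄-swap₃₄ _ e₂ _ _ (inj₂ (inj₁ p≈u₂))        = inj₂ (inj₁ (≈ᴾ-trans p≈u₂ e₂))
  oneOf₄-swap₃₄ _ _ e₃ _ (inj₂ (inj₂ (inj₁ p≈u₃))) = inj₂ (inj₂ (inj₂ (≈ᴾ-trans p≈u₃ e₃)))
  oneOf₄-swap₃₄ _ _ _ e₄ (inj₂ (inj₂ (inj₂ p≈u₄))) = inj₂ (inj₂ (inj₁ (≈ᴾ-trans p≈u₄ e₄)))

  oneOf₄⇒oneOf₂⊎oneOf₂ : ∀ {u₁ u₂ u₃ u₄ p} → OneOf₄ u₁ u₂ u₃ u₄ p → OneOf₂ u₁ u₄ p ⊎ OneOf₂ u₂ u₃ p
  oneOf₄⇒oneOf₂⊎oneOf₂ (inj₁ p≈u₁)               = inj₁ (inj₁ p≈u₁)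
  oneOf₄⇒oneOf₂⊎oneOf₂ (inj₂ (inj₁ p≈u₂))        = inj₂ (inj₁ p≈u₂)
  oneOf₄⇒oneOf₂⊎oneOf₂ (inj₂ (inj₂ (inj₁ p≈u₃))) = inj₂ (inj₂ p≈u₃)
  oneOf₄⇒oneOf₂⊎oneOf₂ (inj₂ (inj₂ (inj₂ p≈u₄))) = inj₁ (inj₂ p≈u₄)

  isVertex⇔oneOf₄ : ∀ {Q} (V : VertexList Q) {p} →
    let open VertexList V in IsVertex Q p ⇔ OneOf₄ v₁ v₂ v₃ v₄ p
  isVertex⇔oneOf₄ {Q} V = mk⇔ to from
    where
    open VertexList V
    to : ∀ {p} → IsVertex Q p → OneOf₄ v₁ v₂ v₃ v₄ p
    to (inj₁ (p∈A , p∈B))                = inj₁ (meet-unique (A Q) (B Q) (npAB Q) p∈A p∈B v₁∈A v₁∈B)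
    to (inj₂ (inj₁ (p∈B , p∈A')))        = inj₂ (inj₁ (meet-unique (B Q) (A' Q) (npBA' Q) p∈B p∈A' v₂∈B v₂∈A'))
    to (inj₂ (inj₂ (inj₁ (p∈A' , p∈B')))) = inj₂ (inj₂ (inj₁ (meet-unique (A' Q) (B' Q) (npA'B' Q) p∈A' p∈B' v₃∈A' v₃∈B')))
    to (inj₂ (inj₂ (inj₂ (p∈B' , p∈A))))  = inj₂ (inj₂ (inj₂ (meet-unique (B' Q) (A Q) (npB'A Q) p∈B' p∈A v₄∈B' v₄∈A)))
    from : ∀ {p} → OneOf₄ v₁ v₂ v₃ v₄ p → IsVertex Q p
    from (inj₁ p≈v₁)               = inj₁ (onLine-resp (A Q) (≈ᴾ-sym p≈v₁) v₁∈A , onLine-resp (B Q) (≈ᴾ-sym p≈v₁) v₁∈B)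
    from (inj₂ (inj₁ p≈v₂))        = inj₂ (inj₁ (onLine-resp (B Q) (≈ᴾ-sym p≈v₂) v₂∈B , onLine-resp (A' Q) (≈ᴾ-sym p≈v₂) v₂∈A'))
    from (inj₂ (inj₂ (inj₁ p≈v₃))) = inj₂ (inj₂ (inj₁ (onLine-resp (A' Q) (≈ᴾ-sym p≈v₃) v₃∈A' , onLine-resp (B' Q) (≈ᴾ-sym p≈v₃) v₃∈B')))
    from (inj₂ (inj₂ (inj₂ p≈v₄))) = inj₂ (inj₂ (inj₂ (onLine-resp (B' Q) (≈ᴾ-sym p≈v₄) v₄∈B' , onLine-resp (A Q) (≈ᴾ-sym p≈v₄) v₄∈A)))

  record AllDistinct (w₁ w₂ w₃ w₄ : Point) : Set ℓ where
    field
      w₁≉w₂ : ¬ w₁ ≈ᴾ w₂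
      w₁≉w₃ : ¬ w₁ ≈ᴾ w₃
      w₁≉w₄ : ¬ w₁ ≈ᴾ w₄
      w₂≉w₃ : ¬ w₂ ≈ᴾ w₃
      w₂≉w₄ : ¬ w₂ ≈ᴾ w₄
      w₃≉w₄ : ¬ w₃ ≈ᴾ w₄

  module _ {P : Quadrilateral} (isPar : IsParallelogram P) (W : VertexList P) where
    open VertexList W

    private
      A∥A' : Parallel (A P) (A' P)
      A∥A' = proj₁ isPar
      B∥B' : Parallel (B P) (B' P)
      B∥B' = proj₂ isPar
      uA : Unimodular (A P)
      uA = ¬parallel⇒unimodular (A P) (B P) (npAB P)
      uB : Unimodular (B P)
      uB = ¬parallel⇒unimodular (B P) (A' P) (npBA' P)
      uA' : Unimodular (A' P)
      uA' = ¬parallel⇒unimodular (A' P) (B' P) (npA'B' P)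
      uB' : Unimodular (B' P)
      uB' = ¬parallel⇒unimodular (B' P) (A P) (npB'A P)

    parallelogram-vertices-distinct : AllDistinct v₁ v₂ v₃ v₄
    parallelogram-vertices-distinct = record
      { w₁≉w₂ = apartA v₁∈A v₂∈A'
      ; w₁≉w₃ = apartA v₁∈A v₃∈A'
      ; w₁≉w₄ = apartB v₁∈B v₄∈B'
      ; w₂≉w₃ = apartB v₂∈B v₃∈B'
      ; w₂≉w₄ = apartB v₂∈B v₄∈B'
      ; w₃≉w₄ = λ v₃≈v₄ → apartA v₄∈A v₃∈A' (≈ᴾ-sym v₃≈v₄)
      }
      where
      apartA : ∀ {p q} → OnLine p (A P) → OnLine q (A' P) → ¬ p ≈ᴾ q
      apartA = parallel-apart (A P) (A' P) A∥A' uA uA' (dAA' P)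
      apartB : ∀ {p q} → OnLine p (B P) → OnLine q (B' P) → ¬ p ≈ᴾ q
      apartB = parallel-apart (B P) (B' P) B∥B' uB uB' (dBB' P)

    parallelogram-diagonals : v₁ +ᴾ v₃ ≈ᴾ v₂ +ᴾ v₄
    parallelogram-diagonals = ¬parallel⇒injective (A P) (B P) (npAB P) onA onB
      where
      onA : A P ⟦ v₁ +ᴾ v₃ ⟧ ≈ A P ⟦ v₂ +ᴾ v₄ ⟧
      onA = begin
        A P ⟦ v₁ +ᴾ v₃ ⟧           ≈⟨ ⟦⟧-+ (A P) v₁ v₃ ⟩
        A P ⟦ v₁ ⟧ + A P ⟦ v₃ ⟧    ≈⟨ +-cong (trans v₁∈A (sym v₄∈A))
                                     (parallel⇒sameLevels (A' P) (A P) (sym A∥A') uA' (trans v₃∈A' (sym v₂∈A'))) ⟩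
        A P ⟦ v₄ ⟧ + A P ⟦ v₂ ⟧    ≈⟨ +-comm _ _ ⟩
        A P ⟦ v₂ ⟧ + A P ⟦ v₄ ⟧    ≈⟨ ⟦⟧-+ (A P) v₂ v₄ ⟨
        A P ⟦ v₂ +ᴾ v₄ ⟧           ∎
      onB : B P ⟦ v₁ +ᴾ v₃ ⟧ ≈ B P ⟦ v₂ +ᴾ v₄ ⟧
      onB = begin
        B P ⟦ v₁ +ᴾ v₃ ⟧           ≈⟨ ⟦⟧-+ (B P) v₁ v₃ ⟩
        B P ⟦ v₁ ⟧ + B P ⟦ v₃ ⟧    ≈⟨ +-cong (trans v₁∈B (sym v₂∈B))
                                     (parallel⇒sameLevels (B' P) (B P) (sym B∥B') uB' (trans v₃∈B' (sym v₄∈B'))) ⟩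
        B P ⟦ v₂ ⟧ + B P ⟦ v₄ ⟧    ≈⟨ ⟦⟧-+ (B P) v₂ v₄ ⟨
        B P ⟦ v₂ +ᴾ v₄ ⟧           ∎

  OnXAxis OnYAxis : Point → Set ℓ
  OnXAxis (x , y) = y ≈ 0#
  OnYAxis (x , y) = x ≈ 0#

  axes-sum-cancel : ∀ {p q r s} → OnXAxis p → OnXAxis q → OnYAxis r → OnYAxis s →
    p +ᴾ r ≈ᴾ q +ᴾ s → p ≈ᴾ q
  axes-sum-cancel {x , _} {x' , _} {u , _} {u' , _} y≈0 y'≈0 u≈0 u'≈0 (sumX , _) =
      (begin
        x        ≈⟨ +-identityʳ x ⟨
        x + 0#   ≈⟨ +-congˡ u≈0 ⟨
        x + u    ≈⟨ sumX ⟩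
        x' + u'  ≈⟨ +-congˡ u'≈0 ⟩
        x' + 0#  ≈⟨ +-identityʳ x' ⟩
        x'       ∎)
    , trans y≈0 (sym y'≈0)

  oneOf₂-pigeonhole : ∀ {u u' p q r} → OneOf₂ u u' p → OneOf₂ u u' q → OneOf₂ u u' r →
    ¬ p ≈ᴾ q → ¬ p ≈ᴾ r → ¬ q ≈ᴾ r → ⊥
  oneOf₂-pigeonhole (inj₁ p≈u) (inj₁ q≈u) _ p≉q _ _ = p≉q (≈ᴾ-trans p≈u (≈ᴾ-sym q≈u))
  oneOf₂-pigeonhole (inj₂ p≈u') (inj₂ q≈u') _ p≉q _ _ = p≉q (≈ᴾ-trans p≈u' (≈ᴾ-sym q≈u'))
  oneOf₂-pigeonhole (inj₁ p≈u) (inj₂ _) (inj₁ r≈u) _ p≉r _ = p≉r (≈ᴾ-trans p≈u (≈ᴾ-sym r≈u))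
  oneOf₂-pigeonhole (inj₁ _) (inj₂ q≈u') (inj₂ r≈u') _ _ q≉r = q≉r (≈ᴾ-trans q≈u' (≈ᴾ-sym r≈u'))
  oneOf₂-pigeonhole (inj₂ _) (inj₁ q≈u) (inj₁ r≈u) _ _ q≉r = q≉r (≈ᴾ-trans q≈u (≈ᴾ-sym r≈u))
  oneOf₂-pigeonhole (inj₂ p≈u') (inj₁ _) (inj₂ r≈u') _ p≉r _ = p≉r (≈ᴾ-trans p≈u' (≈ᴾ-sym r≈u'))

  oneOf₂-sum : ∀ {u u' p q} → OneOf₂ u u' p → OneOf₂ u u' q → ¬ p ≈ᴾ q → p +ᴾ q ≈ᴾ u +ᴾ u'
  oneOf₂-sum (inj₁ p≈u) (inj₁ q≈u) p≉q = ⊥-elim (p≉q (≈ᴾ-trans p≈u (≈ᴾ-sym q≈u)))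
  oneOf₂-sum (inj₁ p≈u) (inj₂ q≈u') _ = +ᴾ-cong p≈u q≈u'
  oneOf₂-sum {u} {u'} (inj₂ p≈u') (inj₁ q≈u) _ = ≈ᴾ-trans (+ᴾ-cong p≈u' q≈u) (+ᴾ-comm u' u)
  oneOf₂-sum (inj₂ p≈u') (inj₂ q≈u') p≉q = ⊥-elim (p≉q (≈ᴾ-trans p≈u' (≈ᴾ-sym q≈u')))

  module AxisPairs {u u' z z' : Point}
    (u∈X : OnXAxis u) (u'∈X : OnXAxis u') (z∈Y : OnYAxis z) (z'∈Y : OnYAxis z') where

    Among : Point → Set ℓ
    Among p = OneOf₂ u u' p ⊎ OneOf₂ z z' p

    onXAxis : ∀ {p} → OneOf₂ u u' p → OnXAxis p
    onXAxis (inj₁ p≈u)  = trans (proj₂ p≈u) u∈X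
    onXAxis (inj₂ p≈u') = trans (proj₂ p≈u') u'∈X

    onYAxis : ∀ {p} → OneOf₂ z z' p → OnYAxis p
    onYAxis (inj₁ p≈z)  = trans (proj₁ p≈z) z∈Y
    onYAxis (inj₂ p≈z') = trans (proj₁ p≈z') z'∈Y

    -- A diagonal joining a point of {u , u'} to one of {z , z'} forces, by comparing
    -- coordinates of the two diagonal sums, two of the points to agree; so the
    -- diagonals are exactly the two pairs.
    diagonals⇒pairSums : ∀ {w₁ w₂ w₃ w₄} → AllDistinct w₁ w₂ w₃ w₄ → w₁ +ᴾ w₃ ≈ᴾ w₂ +ᴾ w₄ →
      Among w₁ → Among w₂ → Among w₃ → Among w₄ → u +ᴾ u' ≈ᴾ z +ᴾ z'
    diagonals⇒pairSums {w₁} {w₂} {w₃} {w₄} D diag = cases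
      where
      open AllDistinct D
      cases : Among w₁ → Among w₂ → Among w₃ → Among w₄ → u +ᴾ u' ≈ᴾ z +ᴾ z'
      cases (inj₁ x₁) (inj₁ x₂) (inj₁ x₃) _ = ⊥-elim (oneOf₂-pigeonhole x₁ x₂ x₃ w₁≉w₂ w₁≉w₃ w₂≉w₃)
      cases (inj₁ x₁) _ (inj₁ x₃) (inj₁ x₄) = ⊥-elim (oneOf₂-pigeonhole x₁ x₃ x₄ w₁≉w₃ w₁≉w₄ w₃≉w₄)
      cases (inj₁ x₁) (inj₂ y₂) (inj₁ x₃) (inj₂ y₄) =
        ≈ᴾ-trans (≈ᴾ-sym (oneOf₂-sum x₁ x₃ w₁≉w₃)) (≈ᴾ-trans diag (oneOf₂-sum y₂ y₄ w₂≉w₄))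
      cases (inj₂ y₁) (inj₂ y₂) (inj₂ y₃) _ = ⊥-elim (oneOf₂-pigeonhole y₁ y₂ y₃ w₁≉w₂ w₁≉w₃ w₂≉w₃)
      cases (inj₂ y₁) _ (inj₂ y₃) (inj₂ y₄) = ⊥-elim (oneOf₂-pigeonhole y₁ y₃ y₄ w₁≉w₃ w₁≉w₄ w₃≉w₄)
      cases (inj₂ y₁) (inj₁ x₂) (inj₂ y₃) (inj₁ x₄) =
        ≈ᴾ-trans (≈ᴾ-sym (oneOf₂-sum x₂ x₄ w₂≉w₄)) (≈ᴾ-trans (≈ᴾ-sym diag) (oneOf₂-sum y₁ y₃ w₁≉w₃))
      cases (inj₁ x₁) (inj₁ x₂) (inj₂ _) (inj₁ x₄) = ⊥-elim (oneOf₂-pigeonhole x₁ x₂ x₄ w₁≉w₂ w₁≉w₄ w₂≉w₄)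
      cases (inj₁ _) (inj₂ y₂) (inj₂ y₃) (inj₂ y₄) = ⊥-elim (oneOf₂-pigeonhole y₂ y₃ y₄ w₂≉w₃ w₂≉w₄ w₃≉w₄)
      cases (inj₁ x₁) (inj₁ x₂) (inj₂ y₃) (inj₂ y₄) =
        ⊥-elim (w₁≉w₂ (axes-sum-cancel (onXAxis x₁) (onXAxis x₂) (onYAxis y₃) (onYAxis y₄) diag))
      cases (inj₁ x₁) (inj₂ y₂) (inj₂ y₃) (inj₁ x₄) =
        ⊥-elim (w₁≉w₄ (axes-sum-cancel (onXAxis x₁) (onXAxis x₄) (onYAxis y₃) (onYAxis y₂)
          (≈ᴾ-trans diag (+ᴾ-comm w₂ w₄))))
      cases (inj₂ _) (inj₁ x₂) (inj₁ x₃) (inj₁ x₄) = ⊥-elim (oneOf₂-pigeonhole x₂ x₃ x₄ w₂≉w₃ w₂≉w₄ w₃≉w₄)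
      cases (inj₂ y₁) (inj₂ y₂) (inj₁ _) (inj₂ y₄) = ⊥-elim (oneOf₂-pigeonhole y₁ y₂ y₄ w₁≉w₂ w₁≉w₄ w₂≉w₄)
      cases (inj₂ y₁) (inj₁ x₂) (inj₁ x₃) (inj₂ y₄) =
        ⊥-elim (w₂≉w₃ (axes-sum-cancel (onXAxis x₂) (onXAxis x₃) (onYAxis y₄) (onYAxis y₁)
          (≈ᴾ-sym (≈ᴾ-trans (+ᴾ-comm w₃ w₁) diag))))
      cases (inj₂ y₁) (inj₂ y₂) (inj₁ x₃) (inj₁ x₄) =
        ⊥-elim (w₃≉w₄ (axes-sum-cancel (onXAxis x₃) (onXAxis x₄) (onYAxis y₁) (onYAxis y₂)
          (≈ᴾ-trans (+ᴾ-comm w₃ w₁) (≈ᴾ-trans diag (+ᴾ-comm w₂ w₄)))))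

  centroid≈origin⇔pairSums : ∀ {v₁ v₂ v₃ v₄} → OnXAxis v₁ → OnYAxis v₂ → OnYAxis v₃ → OnXAxis v₄ →
    IsCentroidOf origin v₁ v₂ v₃ v₄ ⇔ v₁ +ᴾ v₄ ≈ᴾ v₂ +ᴾ v₃
  centroid≈origin⇔pairSums {x₁ , y₁} {x₂ , y₂} {x₃ , y₃} {x₄ , y₄} y₁≈0 x₂≈0 x₃≈0 y₄≈0 = mk⇔
    (λ (sumX , sumY) →
        linear-combination
          (solve 4 (λ x₁ x₂ x₃ x₄ →
              (x₁ :+ x₄) :+ ((:- :1) :* (((x₁ :+ x₂) :+ x₃) :+ x₄) :+ (:- :2) :* :0 :+ (:- :2) :* :0)
           := (x₂ :+ x₃) :+ ((:- :1) :* ((:2 :+ :2) :* :0) :+ (:- :2) :* x₂ :+ (:- :2) :* x₃))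
            refl x₁ x₂ x₃ x₄)
          (+-cong (+-cong (*-congˡ sumX) (*-congˡ x₂≈0)) (*-congˡ x₃≈0))
      , linear-combination
          (solve 4 (λ y₁ y₂ y₃ y₄ →
              (y₁ :+ y₄) :+ (:1 :* (((y₁ :+ y₂) :+ y₃) :+ y₄) :+ :2 :* :0 :+ :2 :* :0)
           := (y₂ :+ y₃) :+ (:1 :* ((:2 :+ :2) :* :0) :+ :2 :* y₁ :+ :2 :* y₄))
            refl y₁ y₂ y₃ y₄)
          (+-cong (+-cong (*-congˡ sumY) (*-congˡ y₁≈0)) (*-congˡ y₄≈0)))
    (λ (pairX , pairY) →
        linear-combination
          (solve 4 (λ x₁ x₂ x₃ x₄ →
              (:2 :+ :2) :* :0 :+ ((:- :1) :* (x₂ :+ x₃) :+ (:- :2) :* :0 :+ (:- :2) :* :0)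
           := (((x₁ :+ x₂) :+ x₃) :+ x₄) :+ ((:- :1) :* (x₁ :+ x₄) :+ (:- :2) :* x₂ :+ (:- :2) :* x₃))
            refl x₁ x₂ x₃ x₄)
          (+-cong (+-cong (*-congˡ pairX) (*-congˡ x₂≈0)) (*-congˡ x₃≈0))
      , linear-combination
          (solve 4 (λ y₁ y₂ y₃ y₄ →
              (:2 :+ :2) :* :0 :+ (:1 :* (y₂ :+ y₃) :+ (:- :2) :* :0 :+ (:- :2) :* :0)
           := (((y₁ :+ y₂) :+ y₃) :+ y₄) :+ (:1 :* (y₁ :+ y₄) :+ (:- :2) :* y₁ :+ (:- :2) :* y₄))
            refl y₁ y₂ y₃ y₄)
          (+-cong (+-cong (*-congˡ pairY) (*-congˡ y₁≈0)) (*-congˡ y₄≈0)))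

  module Rhombus (s t : Carrier) (2st≉0 : ¬ (1# + 1#) * (s * t) ≈ 0#) where

    refute : ∀ {l r} c → (1# + 1#) * (s * t) + c * r ≈ 0# + c * l → ¬ l ≈ r
    refute c identity l≈r = 2st≉0 (linear-combination identity (*-congˡ l≈r))

    t≉0 : ¬ t ≈ 0#
    t≉0 t≈0 = 2st≉0 (trans (*-congˡ (trans (*-congˡ t≈0) (zeroʳ s))) (zeroʳ _))

    normal≉0 : ∀ {b} → ¬ (t ≈ 0# × b ≈ 0#)
    normal≉0 (t≈0 , _) = t≉0 t≈0

    L₁ L₂ L₃ L₄ : Line
    L₁ = line t (- s) (s * t) normal≉0
    L₂ = line t s (s * t) normal≉0
    L₃ = line t (- s) (- (s * t)) normal≉0
    L₄ = line t s (- (s * t)) normal≉0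

    w₁ w₂ w₃ w₄ : Point
    w₁ = (s , 0#)
    w₂ = (0# , t)
    w₃ = (- s , 0#)
    w₄ = (0# , - t)

    w₁∉L₃ : ¬ OnLine w₁ L₃
    w₁∉L₃ = refute 1# (solve 2 (λ s t → :2 :* (s :* t) :+ :1 :* (:- (s :* t)) := :0 :+ :1 :* (t :* s :+ (:- s) :* :0)) refl s t)
    w₁∉L₄ : ¬ OnLine w₁ L₄
    w₁∉L₄ = refute 1# (solve 2 (λ s t → :2 :* (s :* t) :+ :1 :* (:- (s :* t)) := :0 :+ :1 :* (t :* s :+ s :* :0)) refl s t)
    w₂∉L₁ : ¬ OnLine w₂ L₁
    w₂∉L₁ = refute (- 1#) (solve 2 (λ s t → :2 :* (s :* t) :+ (:- :1) :* (s :* t) := :0 :+ (:- :1) :* (t :* :0 :+ (:- s) :* t)) refl s t)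
    w₂∉L₄ : ¬ OnLine w₂ L₄
    w₂∉L₄ = refute 1# (solve 2 (λ s t → :2 :* (s :* t) :+ :1 :* (:- (s :* t)) := :0 :+ :1 :* (t :* :0 :+ s :* t)) refl s t)

    w₁∈L₁ : OnLine w₁ L₁
    w₁∈L₁ = solve 2 (λ s t → t :* s :+ (:- s) :* :0 := s :* t) refl s t
    w₁∈L₂ : OnLine w₁ L₂
    w₁∈L₂ = solve 2 (λ s t → t :* s :+ s :* :0 := s :* t) refl s t
    w₂∈L₂ : OnLine w₂ L₂
    w₂∈L₂ = solve 2 (λ s t → t :* :0 :+ s :* t := s :* t) refl s t
    w₂∈L₃ : OnLine w₂ L₃
    w₂∈L₃ = solve 2 (λ s t → t :* :0 :+ (:- s) :* t := :- (s :* t)) refl s t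
    w₃∈L₃ : OnLine w₃ L₃
    w₃∈L₃ = solve 2 (λ s t → t :* (:- s) :+ (:- s) :* :0 := :- (s :* t)) refl s t
    w₃∈L₄ : OnLine w₃ L₄
    w₃∈L₄ = solve 2 (λ s t → t :* (:- s) :+ s :* :0 := :- (s :* t)) refl s t
    w₄∈L₄ : OnLine w₄ L₄
    w₄∈L₄ = solve 2 (λ s t → t :* :0 :+ s :* (:- t) := :- (s :* t)) refl s t
    w₄∈L₁ : OnLine w₄ L₁
    w₄∈L₁ = solve 2 (λ s t → t :* :0 :+ (:- s) :* (:- t) := s :* t) refl s t

    rhombus : Quadrilateral
    rhombus = record
      { A = L₁ ; B = L₂ ; A' = L₃ ; B' = L₄
      ; dAB   = λ L₁≡L₂ → w₂∉L₁ (from (L₁≡L₂ w₂) w₂∈L₂)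
      ; dAA'  = λ L₁≡L₃ → w₁∉L₃ (to (L₁≡L₃ w₁) w₁∈L₁)
      ; dAB'  = λ L₁≡L₄ → w₁∉L₄ (to (L₁≡L₄ w₁) w₁∈L₁)
      ; dBA'  = λ L₂≡L₃ → w₁∉L₃ (to (L₂≡L₃ w₁) w₁∈L₂)
      ; dBB'  = λ L₂≡L₄ → w₁∉L₄ (to (L₂≡L₄ w₁) w₁∈L₂)
      ; dA'B' = λ L₃≡L₄ → w₂∉L₄ (to (L₃≡L₄ w₂) w₂∈L₃)
      ; notConcurrent = λ (p , p∈L₁ , _ , p∈L₃ , _) → refute 1#
          (solve 2 (λ s t → :2 :* (s :* t) :+ :1 :* (:- (s :* t)) := :0 :+ :1 :* (s :* t)) refl s t)
          (trans (sym p∈L₁) p∈L₃)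
      ; npAB   = refute 1# (solve 2 (λ s t → :2 :* (s :* t) :+ :1 :* (t :* (:- s)) := :0 :+ :1 :* (t :* s)) refl s t)
      ; npBA'  = refute (- 1#) (solve 2 (λ s t → :2 :* (s :* t) :+ (:- :1) :* (t :* s) := :0 :+ (:- :1) :* (t :* (:- s))) refl s t)
      ; npA'B' = refute 1# (solve 2 (λ s t → :2 :* (s :* t) :+ :1 :* (t :* (:- s)) := :0 :+ :1 :* (t :* s)) refl s t)
      ; npB'A  = refute (- 1#) (solve 2 (λ s t → :2 :* (s :* t) :+ (:- :1) :* (t :* s) := :0 :+ (:- :1) :* (t :* (:- s))) refl s t)
      }
      where open Equivalence

    rhombus-isParallelogram : IsParallelogram rhombus
    rhombus-isParallelogram = refl , refl

    rhombus-vertices : VertexList rhombus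
    rhombus-vertices = record
      { v₁∈A  = w₁∈L₁ ; v₁∈B  = w₁∈L₂ ; v₂∈B  = w₂∈L₂ ; v₂∈A' = w₂∈L₃
      ; v₃∈A' = w₃∈L₃ ; v₃∈B' = w₃∈L₄ ; v₄∈B' = w₄∈L₄ ; v₄∈A  = w₄∈L₁ }

  module StandardQuadrilateral {Q : Quadrilateral} (sf : StandardForm Q) where
    open Equivalence

    onA⇔onXAxis : ∀ p → OnLine p (A Q) ⇔ OnXAxis p
    onA⇔onXAxis p@(x , y) = mk⇔
      (λ p∈A → trans (sym value) (to (proj₁ sf p) p∈A))
      (λ y≈0 → from (proj₁ sf p) (trans value y≈0))
      where
      value : lineY=0 ⟦ p ⟧ ≈ y
      value = solve 2 (λ x y → :0 :* x :+ :1 :* y := y) refl x y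

    onA'⇔onYAxis : ∀ p → OnLine p (A' Q) ⇔ OnYAxis p
    onA'⇔onYAxis p@(x , y) = mk⇔
      (λ p∈A' → trans (sym value) (to (proj₂ sf p) p∈A'))
      (λ x≈0 → from (proj₂ sf p) (trans value x≈0))
      where
      value : lineX=0 ⟦ p ⟧ ≈ x
      value = solve 2 (λ x y → :1 :* x :+ :0 :* y := x) refl x y

    origin∉B∩B' : OnLine origin (B Q) → OnLine origin (B' Q) → ⊥
    origin∉B∩B' origin∈B origin∈B' = notConcurrent Q
      (origin , from (onA⇔onXAxis origin) refl , origin∈B , from (onA'⇔onYAxis origin) refl , origin∈B')

    module OnAxes (V : VertexList Q) where
      open VertexList V

      v₁∈X : OnXAxis v₁
      v₁∈X = to (onA⇔onXAxis v₁) v₁∈A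
      v₂∈Y : OnYAxis v₂
      v₂∈Y = to (onA'⇔onYAxis v₂) v₂∈A'
      v₃∈Y : OnYAxis v₃
      v₃∈Y = to (onA'⇔onYAxis v₃) v₃∈A'
      v₄∈X : OnXAxis v₄
      v₄∈X = to (onA⇔onXAxis v₄) v₄∈A

    centroidIsOrigin⇔pairSums : (V : VertexList Q) → let open VertexList V in
      IsCentroidOf origin v₁ v₂ v₃ v₄ ⇔ v₁ +ᴾ v₄ ≈ᴾ v₂ +ᴾ v₃
    centroidIsOrigin⇔pairSums V = centroid≈origin⇔pairSums v₁∈X v₂∈Y v₃∈Y v₄∈X
      where open OnAxes V

    centroidIsOrigin⇒verticesOfParallelogram : CharNot2 → CentroidIsOrigin Q → VerticesOfParallelogram Q
    centroidIsOrigin⇒verticesOfParallelogram 2≉0 centroid =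
      rhombus , rhombus-isParallelogram ,
      λ _ → ⇔-sym (isVertex⇔oneOf₄ rhombus-vertices) ⇔-∘ (sameVertices ⇔-∘ isVertex⇔oneOf₄ V)
      where
      V : VertexList Q
      V = vertexList Q
      open VertexList V
      open OnAxes V
      s t : Carrier
      s = proj₁ v₁
      t = proj₂ v₂
      pairSums : v₁ +ᴾ v₄ ≈ᴾ v₂ +ᴾ v₃
      pairSums = to (centroidIsOrigin⇔pairSums V) (centroid v₁ v₂ v₃ v₄ v₁∈A v₁∈B v₂∈B v₂∈A' v₃∈A' v₃∈B' v₄∈B' v₄∈A)
      v₄≈-s : proj₁ v₄ ≈ - s
      v₄≈-s = +-inverseʳ-unique s (proj₁ v₄) (trans (proj₁ pairSums) (trans (+-cong v₂∈Y v₃∈Y) (+-identityʳ 0#)))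
      v₃≈-t : proj₂ v₃ ≈ - t
      v₃≈-t = +-inverseʳ-unique t (proj₂ v₃) (trans (sym (proj₂ pairSums)) (trans (+-cong v₁∈X v₄∈X) (+-identityʳ 0#)))
      s≉0 : ¬ s ≈ 0#
      s≉0 s≈0 = origin∉B∩B'
        (onLine-resp (B Q) (s≈0 , v₁∈X) v₁∈B)
        (onLine-resp (B' Q) (trans v₄≈-s (trans (-‿cong s≈0) -0#≈0#) , v₄∈X) v₄∈B')
      t≉0 : ¬ t ≈ 0#
      t≉0 t≈0 = origin∉B∩B'
        (onLine-resp (B Q) (v₂∈Y , t≈0) v₂∈B)
        (onLine-resp (B' Q) (v₃∈Y , trans v₃≈-t (trans (-‿cong t≈0) -0#≈0#)) v₃∈B')
      open Rhombus s t (nonzero-* 2≉0 (nonzero-* s≉0 t≉0))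
      sameVertices : ∀ {p} → OneOf₄ v₁ v₂ v₃ v₄ p ⇔ OneOf₄ w₁ w₂ w₃ w₄ p
      sameVertices = mk⇔
        (oneOf₄-swap₃₄ (refl , v₁∈X) (v₂∈Y , refl) (v₃∈Y , v₃≈-t) (v₄≈-s , v₄∈X))
        (oneOf₄-swap₃₄ (refl , sym v₁∈X) (sym v₂∈Y , refl) (sym v₄≈-s , sym v₄∈X) (sym v₃∈Y , sym v₃≈-t))

    verticesOfParallelogram⇒centroidIsOrigin : VerticesOfParallelogram Q → CentroidIsOrigin Q
    verticesOfParallelogram⇒centroidIsOrigin (P , isPar , sameVertices) v₁ v₂ v₃ v₄ v₁∈A v₁∈B v₂∈B v₂∈A' v₃∈A' v₃∈B' v₄∈B' v₄∈A =
      from (centroidIsOrigin⇔pairSums V)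
        (diagonals⇒pairSums (parallelogram-vertices-distinct isPar W) (parallelogram-diagonals isPar W)
          (among (inj₁ ≈ᴾ-refl)) (among (inj₂ (inj₁ ≈ᴾ-refl)))
          (among (inj₂ (inj₂ (inj₁ ≈ᴾ-refl)))) (among (inj₂ (inj₂ (inj₂ ≈ᴾ-refl)))))
      where
      V : VertexList Q
      V = record { v₁∈A = v₁∈A ; v₁∈B = v₁∈B ; v₂∈B = v₂∈B ; v₂∈A' = v₂∈A'
                 ; v₃∈A' = v₃∈A' ; v₃∈B' = v₃∈B' ; v₄∈B' = v₄∈B' ; v₄∈A = v₄∈A }
      W : VertexList P
      W = vertexList P
      open OnAxes V
      open AxisPairs v₁∈X v₄∈X v₂∈Y v₃∈Y
      open VertexList W using () renaming (v₁ to w₁; v₂ to w₂; v₃ to w₃; v₄ to w₄)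
      among : ∀ {p} → OneOf₄ w₁ w₂ w₃ w₄ p → Among p
      among p∈W = oneOf₄⇒oneOf₂⊎oneOf₂
        (to (isVertex⇔oneOf₄ V) (from (sameVertices _) (from (isVertex⇔oneOf₄ W) p∈W)))

corollary4p5 : {c ℓ : Level} (F : Field c ℓ) → Geometry.CharNot2 F →
    (Q : Geometry.Quadrilateral F) → Geometry.StandardForm F Q →
    Geometry.CentroidIsOrigin F Q ⇔ Geometry.VerticesOfParallelogram F Q
corollary4p5 F 2≉0 Q sf = mk⇔
  (centroidIsOrigin⇒verticesOfParallelogram 2≉0)
  verticesOfParallelogram⇒centroidIsOrigin
  where open PlaneGeometry.StandardQuadrilateral F {Q} sf
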